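{- For every marginally large tableau $T\in\mathcal T(\infty)$ of type $D_n$ and every $i\in\{1,\dots,n\}$, the tableaux $f_iT$ and $e_iT$ (the latter possibly $0$) computed using the far-Eastern reading coincide with those computed using the middle-Eastern reading.
   Context: Let $n\ge4$. $\mathcal T(\infty)$ is the set of left-justified tableaux with $n-1$ rows on the alphabet $1\prec2\prec\cdots\prec n-1\prec \{n,\overline n\}\prec\overline{n-1}\prec\cdots\prec\overline1$ ($n,\overline n$ incomparable) such that: the first column is $1,2,\dots,n-1$; entries weakly increase along rows; the number of $i$-boxes in row $i$ is exactly one more than the total number of boxes in row $i+1$ (row $n$ being empty); every entry in row $i$ is $\preceq\overline i$; $n$ and $\overline n$ do not both appear in one row. The fundamental crystal of type $D_n$ has $i$-arrows $i\to i+1$ and $\overline{i+1}\to\overline i$ for $1\le i\le n-2$; $(n-1)$-arrows $n-1\to n$ and $\overline n\to\overline{n-1}$; $n$-arrows $n-1\to\overline n$ and $n\to\overline{n-1}$. A reading of $T$ is a total order of all its boxes (all boxes included): the middle-Eastern reading reads each row from right to left, rows from top to bottom; the far-Eastern reading reads each column from top to bottom, columns from right to left. Given a reading, the bracketing sequence places ')' under each letter with an $i$-arrow entering it and '(' under each letter with an $i$-arrow leaving it, in reading order; successively cancel adjacent '()' pairs until a sequence $)\cdots)(\cdots($ remains. $f_iT$: replace the box of the letter of the leftmost uncanceled '(' by the box at the other end of its $i$-arrow; if the result is not marginally large, insert one column with entries $1,\dots,\min(i,n-1)$ so that it becomes marginally large. $e_iT$: replace the box of the letter of the rightmost uncanceled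 ')' by the box at the other end of its $i$-arrow, and if the result is not marginally large delete one column with entries $1,\dots,\min(i,n-1)$ to make it so; if there is no uncanceled ')', $e_iT=0$. -}

module Defs where

open import Data.Nat using (ℕ; zero; suc; _+_; _∸_; _≤ᵇ_; _<ᵇ_; _≡ᵇ_; _⊔_; _⊓_)
open import Data.Bool using (Bool; true; false; _∧_; _∨_; not; if_then_else_)
open import Data.List using (List; []; _∷_; length; reverse; concatMap; upTo; foldr; map; _++_)
open import Data.Maybe using (Maybe; just; nothing)
open import Data.Product using (_×_; _,_)

-- Alphabet of type D_n:  pos k = k,  neg k = \overline k   (1 ≤ k ≤ n)

data Letter : Set where
  pos : ℕ → Letter
  neg : ℕ → Letter

_==L_ : Letter → Letter → Bool
pos a ==L pos b = a ≡ᵇ b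
neg a ==L neg b = a ≡ᵇ b
_     ==L _     = false

validLetter : ℕ → Letter → Bool
validLetter n (pos k) = (1 ≤ᵇ k) ∧ (k ≤ᵇ n)
validLetter n (neg k) = (1 ≤ᵇ k) ∧ (k ≤ᵇ n)

-- position in the chain 1 ≺ … ≺ n-1 ≺ {n, n̄} ≺ n-1̄ ≺ … ≺ 1̄
rank : ℕ → Letter → ℕ
rank n (pos k) = k
rank n (neg k) = (2 + n + n) ∸ k

_⪯[_]_ : Letter → ℕ → Letter → Bool
a ⪯[ n ] b = (a ==L b) ∨
  ((rank n a <ᵇ rank n b) ∧ not ((a ==L pos n) ∧ (b ==L neg n)))

-- Tableaux: list of rows (top row first), each row a list of letters
-- (left to right).

Tableau : Set
Tableau = List (List Letter)

allB : {A : Set} → (A → Bool) → List A → Bool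
allB p = foldr (λ x b → p x ∧ b) true

anyB : {A : Set} → (A → Bool) → List A → Bool
anyB p = foldr (λ x b → p x ∨ b) false

count : Letter → List Letter → ℕ
count a = foldr (λ x m → if x ==L a then suc m else m) 0

weaklyIncr : ℕ → List Letter → Bool
weaklyIncr n []            = true
weaklyIncr n (a ∷ [])      = true
weaklyIncr n (a ∷ b ∷ xs)  = (a ⪯[ n ] b) ∧ weaklyIncr n (b ∷ xs)

firstIs : Letter → List Letter → Bool
firstIs a []      = false
firstIs a (x ∷ _) = x ==L a

-- conditions on row i (1-based), given the length of row i+1
rowOK : ℕ → ℕ → List Letter → ℕ → Bool
rowOK n i r nextLen =
  firstIs (pos i) r ∧
  allB (validLetter n) r ∧
  weaklyIncr n r ∧
  (count (pos i) r ≡ᵇ suc nextLen) ∧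
  allB (λ x → x ⪯[ n ] neg i) r ∧
  not (anyB (_==L pos n) r ∧ anyB (_==L neg n) r)

headLen : Tableau → ℕ
headLen []      = 0
headLen (r ∷ _) = length r

rowsOK : ℕ → ℕ → Tableau → Bool
rowsOK n i []       = true
rowsOK n i (r ∷ rs) = rowOK n i r (headLen rs) ∧ rowsOK n (suc i) rs

isMarginallyLarge : ℕ → Tableau → Bool
isMarginallyLarge n T = (length T ≡ᵇ (n ∸ 1)) ∧ rowsOK n 1 T

-- The fundamental crystal of type D_n: the i-arrows (source , target)

arrows : ℕ → ℕ → List (Letter × Letter)
arrows n i =
  if (1 ≤ᵇ i) ∧ (i + 2 ≤ᵇ n)
  then (pos i , pos (suc i)) ∷ (neg (suc i) , neg i) ∷ []
  else if (i ≡ᵇ n ∸ 1)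
  then (pos (n ∸ 1) , pos n) ∷ (neg n , neg (n ∸ 1)) ∷ []
  else if (i ≡ᵇ n)
  then (pos (n ∸ 1) , neg n) ∷ (pos n , neg (n ∸ 1)) ∷ []
  else []

arrowOut : ℕ → ℕ → Letter → Maybe Letter
arrowOut n i a = foldr (λ { (s , t) m → if s ==L a then just t else m }) nothing (arrows n i)

arrowIn : ℕ → ℕ → Letter → Maybe Letter
arrowIn n i a = foldr (λ { (s , t) m → if t ==L a then just s else m }) nothing (arrows n i)

-- Boxes and readings.  A box is (row , column , entry), 0-based.

Box : Set
Box = ℕ × ℕ × Letter

Reading : Set
Reading = Tableau → List Box

indexed : {A : Set} → ℕ → List A → List (ℕ × A)
indexed k []       = []
indexed k (x ∷ xs) = (k , x) ∷ indexed (suc k) xs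

rowBoxes : ℕ → List Letter → List Box
rowBoxes r row = map (λ { (c , a) → (r , c , a) }) (indexed 0 row)

middleEastern : Reading
middleEastern T = concatMap (λ { (r , row) → reverse (rowBoxes r row) }) (indexed 0 T)

entryAt : List Letter → ℕ → Maybe Letter
entryAt []       _       = nothing
entryAt (x ∷ _)  zero    = just x
entryAt (_ ∷ xs) (suc c) = entryAt xs c

width : Tableau → ℕ
width = foldr (λ r m → length r ⊔ m) 0

columnBoxes : Tableau → ℕ → List Box
columnBoxes T c = concatMap f (indexed 0 T)
  where
  f : ℕ × List Letter → List Box
  f (r , row) with entryAt row c
  ... | just a  = (r , c , a) ∷ []
  ... | nothing = []

farEastern : Reading
farEastern T = concatMap (columnBoxes T) (reverse (upTo (width T)))

data Bracket : Set where
  opn cls : Bracket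

bracketOf : ℕ → ℕ → Box → List (Bracket × Box)
bracketOf n i (r , c , a) with arrowIn n i a | arrowOut n i a
... | just _  | _       = (cls , (r , c , a)) ∷ []
... | nothing | just _  = (opn , (r , c , a)) ∷ []
... | nothing | nothing = []

bracketSeq : ℕ → ℕ → List Box → List (Bracket × Box)
bracketSeq n i = concatMap (bracketOf n i)

cancelOnce : List (Bracket × Box) → List (Bracket × Box)
cancelOnce []                              = []
cancelOnce ((opn , _) ∷ (cls , _) ∷ xs)    = xs
cancelOnce (x ∷ xs)                        = x ∷ cancelOnce xs

iterate : {A : Set} → ℕ → (A → A) → A → A
iterate zero    f x = x
iterate (suc k) f x = iterate k f (f x)

-- successively cancel adjacent "()" pairs (length-many steps suffice)
reduced : List (Bracket × Box) → List (Bracket × Box)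
reduced s = iterate (length s) cancelOnce s

leftmostOpen : List (Bracket × Box) → Maybe Box
leftmostOpen []               = nothing
leftmostOpen ((opn , b) ∷ _)  = just b
leftmostOpen ((cls , _) ∷ xs) = leftmostOpen xs

rightmostClose : List (Bracket × Box) → Maybe Box
rightmostClose s = go (reverse s)
  where
  go : List (Bracket × Box) → Maybe Box
  go []               = nothing
  go ((cls , b) ∷ _)  = just b
  go ((opn , _) ∷ xs) = go xs

setAt : List Letter → ℕ → Letter → List Letter
setAt []       _       a = []
setAt (_ ∷ xs) zero    a = a ∷ xs
setAt (x ∷ xs) (suc c) a = x ∷ setAt xs c a

replaceBox : Tableau → ℕ → ℕ → Letter → Tableau
replaceBox []         _       c a = []
replaceBox (row ∷ rs) zero    c a = setAt row c a ∷ rs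
replaceBox (row ∷ rs) (suc r) c a = row ∷ replaceBox rs r c a

insertColumn : ℕ → Tableau → Tableau
insertColumn k T = map (λ { (r , row) → if r <ᵇ k then pos (suc r) ∷ row else row }) (indexed 0 T)

removeFirst : Letter → List Letter → List Letter
removeFirst a []       = []
removeFirst a (x ∷ xs) = if x ==L a then xs else x ∷ removeFirst a xs

deleteColumn : ℕ → Tableau → Tableau
deleteColumn k T = map (λ { (r , row) → if r <ᵇ k then removeFirst (pos (suc r)) row else row }) (indexed 0 T)

-- Kashiwara operators computed with respect to a given reading.
-- nothing stands for 0 (no uncanceled bracket of the required kind).

fOp : ℕ → ℕ → Reading → Tableau → Maybe Tableau
fOp n i rd T with leftmostOpen (reduced (bracketSeq n i (rd T)))
... | nothing = nothing
... | just (r , c , a) with arrowOut n i a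
...   | nothing = nothing
...   | just b  =
        let T' = replaceBox T r c b in
        just (if isMarginallyLarge n T' then T' else insertColumn (i ⊓ (n ∸ 1)) T')

eOp : ℕ → ℕ → Reading → Tableau → Maybe Tableau
eOp n i rd T with rightmostClose (reduced (bracketSeq n i (rd T)))
... | nothing = nothing
... | just (r , c , a) with arrowIn n i a
...   | nothing = nothing
...   | just b  =
        let T' = replaceBox T r c b in
        just (if isMarginallyLarge n T' then T' else deleteColumn (i ⊓ (n ∸ 1)) T')

-- Let k be the row whose letter k is the source of an i-arrow (k = i for i ≤ n-2, k = n-1
-- otherwise).  In a marginally large tableau row l starts with more l's than row l+1 has boxes,
-- and all its letters lie between l and l̄.  Hence letters l < k carry no bracket, rows k+2, …
-- carry none either, and every k in row k carries a '('.  Above row k both readings therefore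
-- produce the same brackets: those of the part of each row that sticks out beyond the next row.
-- From row k on, both bracket words begin with the '(' of the rightmost k of row k, and the rest
-- reduces to '('s only: in the far-Eastern reading every k is followed by at most one bracket, from
-- the box below it; in the middle-Eastern reading the m+1 k's precede the at most m brackets of
-- row k+1 (m its length).  So the two reduced words differ only in a tail of '('s behind a common
-- '(', which changes neither the leftmost uncancelled '(' nor the rightmost uncancelled ')'.

module Submission where

open import Defs
open import Data.Bool using (true; false; _∧_)
open import Data.Bool.Properties using (∧-conicalˡ; ∧-conicalʳ; ∧-zeroʳ; T-≡; ¬-not)
open import Data.Empty using (⊥-elim)
open import Data.List
  using (List; []; _∷_; _++_; [_]; length; reverse; concatMap; map; foldr; replicate; drop;
         downFrom; applyDownFrom)
open import Data.List.Properties
  using (++-assoc; ∷-injectiveʳ; ++-identityʳ; concatMap-++; concatMap-cong; concatMap-map; foldr-++;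
         length-++; length-map; length-replicate; length-downFrom; reverse-++; reverse-upTo; downFrom-∷ʳ;
         map-downFrom; drop-all)
open import Data.List.Relation.Unary.All as All using (All; []; _∷_)
open import Data.List.Relation.Unary.All.Properties using (applyDownFrom⁺₁; applyDownFrom⁺₂)
open import Data.Maybe using (Maybe; just; nothing; _<∣>_)
open import Data.Nat
  using (ℕ; zero; suc; _+_; _∸_; _⊔_; _≤_; _<_; z≤n; s≤s; _≤ᵇ_; _≡ᵇ_)
open import Data.Nat.Properties
open import Data.Product using (_×_; _,_; proj₁; proj₂; ∃-syntax)
open import Data.Sum using (_⊎_; inj₁; inj₂)
open import Function using (_∘_; id)
open import Function.Bundles using (Equivalence)
open import Relation.Nullary using (¬_; yes; no)
open import Relation.Binary.PropositionalEquality hiding ([_])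

∧-true : ∀ {x y} → x ∧ y ≡ true → x ≡ true × y ≡ true
∧-true {x} {y} e = ∧-conicalˡ x y e , ∧-conicalʳ x y e

≡ᵇ-true⇒≡ : ∀ {m n} → (m ≡ᵇ n) ≡ true → m ≡ n
≡ᵇ-true⇒≡ {m} {n} e = ≡ᵇ⇒≡ m n (Equivalence.from T-≡ e)

≡ᵇ-refl : ∀ m → (m ≡ᵇ m) ≡ true
≡ᵇ-refl zero    = refl
≡ᵇ-refl (suc m) = ≡ᵇ-refl m

≢⇒≡ᵇ-false : ∀ {m n} → m ≢ n → (m ≡ᵇ n) ≡ false
≢⇒≡ᵇ-false m≢n = ¬-not (m≢n ∘ ≡ᵇ-true⇒≡)

≤⇒≤ᵇ-true : ∀ {m n} → m ≤ n → (m ≤ᵇ n) ≡ true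
≤⇒≤ᵇ-true m≤n = Equivalence.to T-≡ (≤⇒≤ᵇ m≤n)

≰⇒≤ᵇ-false : ∀ {m n} → ¬ m ≤ n → (m ≤ᵇ n) ≡ false
≰⇒≤ᵇ-false {m} {n} m≰n = ¬-not (m≰n ∘ ≤ᵇ⇒≤ m n ∘ Equivalence.from T-≡)

==L⇒≡ : ∀ a b → a ==L b ≡ true → a ≡ b
==L⇒≡ (pos x) (pos y) e = cong pos (≡ᵇ-true⇒≡ e)
==L⇒≡ (neg x) (neg y) e = cong neg (≡ᵇ-true⇒≡ e)

==L-refl : ∀ a → a ==L a ≡ true
==L-refl (pos x) = ≡ᵇ-refl x
==L-refl (neg x) = ≡ᵇ-refl x

rank≢⇒==L-false : ∀ {n} a b → rank n a ≢ rank n b → a ==L b ≡ false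
rank≢⇒==L-false {n} a b ne = ¬-not (ne ∘ cong (rank n) ∘ ==L⇒≡ a b)

⪯⇒≡⊎rank< : ∀ {n a b} → a ⪯[ n ] b ≡ true → a ≡ b ⊎ rank n a < rank n b
⪯⇒≡⊎rank< {n} {a} {b} e with a ==L b in eq
... | true  = inj₁ (==L⇒≡ a b eq)
... | false = inj₂ (<ᵇ⇒< _ _ (Equivalence.from T-≡ (proj₁ (∧-true e))))

⪯⇒rank≤ : ∀ {n a b} → a ⪯[ n ] b ≡ true → rank n a ≤ rank n b
⪯⇒rank≤ {n} {a} {b} e with ⪯⇒≡⊎rank< {n} {a} {b} e
... | inj₁ refl = ≤-refl
... | inj₂ a<b  = <⇒≤ a<b

rank-lowerBound : ∀ n a xs → weaklyIncr n (a ∷ xs) ≡ true → All (λ x → rank n a ≤ rank n x) (a ∷ xs)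
rank-lowerBound n a [] _ = ≤-refl ∷ []
rank-lowerBound n a (b ∷ xs) e with ∧-true {a ⪯[ n ] b} e
... | a⪯b , inc = ≤-refl ∷ All.map (≤-trans (⪯⇒rank≤ {n} {a} {b} a⪯b)) (rank-lowerBound n b xs inc)

count-absent : ∀ n a xs → All (λ x → rank n a < rank n x) xs → count a xs ≡ 0
count-absent n a [] [] = refl
count-absent n a (x ∷ xs) (a<x ∷ a<xs) rewrite rank≢⇒==L-false {n} x a (>⇒≢ a<x) = count-absent n a xs a<xs

count-head : ∀ a xs → count a (a ∷ xs) ≡ suc (count a xs)
count-head a xs rewrite ==L-refl a = refl

weaklyIncr-prefix : ∀ n a xs → weaklyIncr n (a ∷ xs) ≡ true → ∃[ N ] xs ≡ replicate (count a xs) a ++ N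
weaklyIncr-prefix n a [] _ = [] , refl
weaklyIncr-prefix n a (b ∷ ys) e with ∧-true {a ⪯[ n ] b} e
... | a⪯b , inc with ⪯⇒≡⊎rank< {n} {a} {b} a⪯b
...   | inj₁ refl with weaklyIncr-prefix n a ys inc
...     | N , ys≡ rewrite count-head a ys = N , cong (a ∷_) ys≡
weaklyIncr-prefix n a (b ∷ ys) e | a⪯b , inc | inj₂ a<b =
  b ∷ ys , cong (λ k → replicate k a ++ b ∷ ys) (sym (count-absent n a (b ∷ ys) a<b∷ys))
  where
  a<b∷ys = All.map (<-≤-trans a<b) (rank-lowerBound n b ys inc)

rowOK-parts : ∀ n l R d → rowOK n l R d ≡ true →
  firstIs (pos l) R ≡ true × weaklyIncr n R ≡ true × count (pos l) R ≡ suc d ×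
  allB (λ x → x ⪯[ n ] neg l) R ≡ true
rowOK-parts n l R d ok
  with ∧-true {firstIs (pos l) R} ok
... | first , ok₁ with ∧-true {allB (validLetter n) R} ok₁
... | _ , ok₂ with ∧-true {weaklyIncr n R} ok₂
... | inc , ok₃ with ∧-true {count (pos l) R ≡ᵇ suc d} ok₃
... | cnt , ok₄ = first , inc , ≡ᵇ-true⇒≡ cnt , proj₁ (∧-true {allB (λ x → x ⪯[ n ] neg l) R} ok₄)

row-shape : ∀ n l R d → rowOK n l R d ≡ true → ∃[ N ] R ≡ replicate (suc d) (pos l) ++ N
row-shape n l [] d ok with rowOK-parts n l [] d ok
... | () , _
row-shape n l (x ∷ xs) d ok with rowOK-parts n l (x ∷ xs) d ok
... | first , inc , cnt , _ with ==L⇒≡ x (pos l) first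
... | refl with weaklyIncr-prefix n (pos l) xs inc
... | N , xs≡ = N , cong (pos l ∷_) (trans xs≡ (cong (λ k → replicate k (pos l) ++ N) count≡d))
  where
  count≡d : count (pos l) xs ≡ d
  count≡d = suc-injective (trans (sym (count-head (pos l) xs)) cnt)

InBand : ℕ → ℕ → Letter → Set
InBand n l x = l ≤ rank n x × rank n x ≤ rank n (neg l)

row-inBand : ∀ n l R d → rowOK n l R d ≡ true → All (InBand n l) R
row-inBand n l [] d ok = []
row-inBand n l (x ∷ xs) d ok with rowOK-parts n l (x ∷ xs) d ok
... | first , inc , _ , below with ==L⇒≡ x (pos l) first
... | refl = bounded (rank-lowerBound n (pos l) xs inc) below
  where
  bounded : ∀ {ys} → All (λ y → l ≤ rank n y) ys → allB (λ y → y ⪯[ n ] neg l) ys ≡ true → All (InBand n l) ys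
  bounded [] _ = []
  bounded {y ∷ ys} (l≤y ∷ l≤ys) e with ∧-true {y ⪯[ n ] neg l} e
  ... | y⪯ , ys⪯ = (l≤y , ⪯⇒rank≤ {n} {y} y⪯) ∷ bounded l≤ys ys⪯

length-replicate-++ : ∀ d (a : Letter) N → d ≤ length (replicate d a ++ N)
length-replicate-++ d a N =
  subst (d ≤_) (sym (trans (length-++ (replicate d a)) (cong (_+ length N) (length-replicate d)))) (m≤m+n d _)

row-longer : ∀ n l R d → rowOK n l R d ≡ true → d < length R
row-longer n l R d ok with row-shape n l R d ok
... | N , refl = length-replicate-++ (suc d) (pos l) N

width-rowsOK : ∀ n l T → rowsOK n l T ≡ true → width T ≡ headLen T
width-rowsOK n l [] _ = refl
width-rowsOK n l (R ∷ T) ok with ∧-true {rowOK n l R (headLen T)} ok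
... | okR , okT = trans (cong (length R ⊔_) (width-rowsOK n (suc l) T okT))
                        (m≥n⇒m⊔n≡m (<⇒≤ (row-longer n l R (headLen T) okR)))

-- The two readings, column by column

entryAt-replicate : ∀ {d c} (a : Letter) N → c < d → entryAt (replicate d a ++ N) c ≡ just a
entryAt-replicate {suc d} {zero}  a N _   = refl
entryAt-replicate {suc d} {suc c} a N c<d = entryAt-replicate a N (≤-pred c<d)

entryAt-beyond : ∀ R {c} → length R ≤ c → entryAt R c ≡ nothing
entryAt-beyond []                _   = refl
entryAt-beyond (_ ∷ R) {suc c} R≤c = entryAt-beyond R (≤-pred R≤c)

All-entryAt : ∀ {P : Letter → Set} {R c a} → All P R → entryAt R c ≡ just a → P a
All-entryAt {R = _ ∷ _} {zero}  (p ∷ _)  refl = p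
All-entryAt {R = _ ∷ _} {suc c} (_ ∷ ps) e    = All-entryAt ps e

concatMap-congᴬ : ∀ {A B : Set} {f g : A → List B} {xs} → All (λ x → f x ≡ g x) xs →
  concatMap f xs ≡ concatMap g xs
concatMap-congᴬ []       = refl
concatMap-congᴬ (e ∷ es) = cong₂ _++_ e (concatMap-congᴬ es)

concatIndexed : {A B : Set} → (ℕ → A → List B) → ℕ → List A → List B
concatIndexed h k []       = []
concatIndexed h k (x ∷ xs) = h k x ++ concatIndexed h (suc k) xs

concatMap-indexed : ∀ {A B : Set} {g : ℕ × A → List B} {h : ℕ → A → List B} →
  (∀ k x → g (k , x) ≡ h k x) → ∀ k xs → concatMap g (indexed k xs) ≡ concatIndexed h k xs
concatMap-indexed g≡h k []       = refl
concatMap-indexed g≡h k (x ∷ xs) = cong₂ _++_ (g≡h k x) (concatMap-indexed g≡h (suc k) xs)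

cellAt : ℕ → ℕ → Maybe Letter → List Box
cellAt r c (just a) = (r , c , a) ∷ []
cellAt r c nothing  = []

cell : ℕ → List Letter → ℕ → List Box
cell r R c = cellAt r c (entryAt R c)

column : ℕ → Tableau → ℕ → List Box
column r T c = concatIndexed (λ r R → cell r R c) r T

farFrom : ℕ → Tableau → List Box
farFrom r T = concatMap (column r T) (downFrom (width T))

rowReading : ℕ → List Letter → List Box
rowReading r R = concatMap (cell r R) (downFrom (length R))

middleFrom : ℕ → Tableau → List Box
middleFrom = concatIndexed rowReading

-- `columnBoxes` is defined through a local function, which we name by unification.
mutual
  private
    columnEntry : Tableau → ℕ → ℕ × List Letter → List Box
    columnEntry = _

    columnBoxes-unfold : ∀ T c → columnBoxes T c ≡ concatMap (columnEntry T c) (indexed 0 T)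
    columnBoxes-unfold T c = refl

columnEntry≡cell : ∀ T c r R → columnEntry T c (r , R) ≡ cell r R c
columnEntry≡cell T c r R with entryAt R c
... | just a  = refl
... | nothing = refl

farEastern≡farFrom : ∀ T → farEastern T ≡ farFrom 0 T
farEastern≡farFrom T =
  trans (cong (concatMap (columnBoxes T)) (reverse-upTo (width T)))
        (concatMap-cong (λ c → trans (columnBoxes-unfold T c) (concatMap-indexed (columnEntry≡cell T c) 0 T))
                        (downFrom (width T)))

reverse-indexedBoxes : ∀ {r} {g : ℕ × Letter → Box} → (∀ c a → g (c , a) ≡ (r , c , a)) → ∀ k R →
  reverse (map g (indexed k R)) ≡ concatMap (λ j → cellAt r (k + j) (entryAt R j)) (downFrom (length R))
reverse-indexedBoxes g≡ k [] = refl
reverse-indexedBoxes {r} {g} g≡ k (a ∷ R) = begin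
  reverse (g (k , a) ∷ map g (indexed (suc k) R))
    ≡⟨ reverse-++ [ g (k , a) ] (map g (indexed (suc k) R)) ⟩
  reverse (map g (indexed (suc k) R)) ++ [ g (k , a) ]
    ≡⟨ cong₂ _++_ (reverse-indexedBoxes g≡ (suc k) R) (cong [_] (g≡ k a)) ⟩
  concatMap (λ j → cellAt r (suc k + j) (entryAt R j)) (downFrom (length R)) ++ [ (r , k , a) ]
    ≡⟨ cong₂ _++_ (concatMap-cong (λ j → cong (λ c → cellAt r c (entryAt R j)) (sym (+-suc k j))) (downFrom (length R)))
                  (cong (λ c → [ (r , c , a) ]) (sym (+-identityʳ k))) ⟩
  concatMap (F ∘ suc) (downFrom (length R)) ++ F 0
    ≡⟨ cong₂ _++_ (sym (trans (cong (concatMap F) (sym (map-downFrom suc (length R))))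
                               (concatMap-map F suc (downFrom (length R)))))
                  (sym (++-identityʳ (F 0))) ⟩
  concatMap F (applyDownFrom suc (length R)) ++ concatMap F [ 0 ]
    ≡⟨ sym (concatMap-++ F (applyDownFrom suc (length R)) [ 0 ]) ⟩
  concatMap F (applyDownFrom suc (length R) ++ [ 0 ])
    ≡⟨ cong (concatMap F) (downFrom-∷ʳ (length R)) ⟩
  concatMap F (downFrom (suc (length R))) ∎
  where
  open ≡-Reasoning
  F : ℕ → List Box
  F j = cellAt r (k + j) (entryAt (a ∷ R) j)

middleEastern≡middleFrom : ∀ T → middleEastern T ≡ middleFrom 0 T
middleEastern≡middleFrom = concatMap-indexed (λ r R → reverse-indexedBoxes (λ c a → refl) 0 R) 0

downFrom-+ : ∀ w d → downFrom (d + w) ≡ applyDownFrom (_+ w) d ++ downFrom w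
downFrom-+ w zero    = refl
downFrom-+ w (suc d) = cong (d + w ∷_) (downFrom-+ w d)

-- the columns L-1, …, w, in this order
columnsFrom : ℕ → ℕ → List ℕ
columnsFrom w L = applyDownFrom (_+ w) (L ∸ w)

cellsFrom : ℕ → List Letter → ℕ → List Box
cellsFrom r R w = concatMap (cell r R) (columnsFrom w (length R))

downFrom-split : ∀ {w L} → w ≤ L → downFrom L ≡ columnsFrom w L ++ downFrom w
downFrom-split {w} {L} w≤L = trans (cong downFrom (sym (m∸n+n≡m w≤L))) (downFrom-+ w (L ∸ w))

rowReading-split : ∀ r R {w} → w ≤ length R →
  rowReading r R ≡ cellsFrom r R w ++ concatMap (cell r R) (downFrom w)
rowReading-split r R {w} w≤R =
  trans (cong (concatMap (cell r R)) (downFrom-split w≤R))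
        (concatMap-++ (cell r R) (columnsFrom w (length R)) (downFrom w))

column-beyond : ∀ r T {c} → width T ≤ c → column r T c ≡ []
column-beyond r []      _   = refl
column-beyond r (R ∷ T) T≤c
  rewrite entryAt-beyond R (≤-trans (m≤m⊔n (length R) (width T)) T≤c) =
  column-beyond (suc r) T (≤-trans (m≤n⊔m (length R) (width T)) T≤c)

farFrom-split : ∀ r R T {w} → width T ≤ w → w ≤ length R →
  farFrom r (R ∷ T) ≡ cellsFrom r R w ++ concatMap (column r (R ∷ T)) (downFrom w)
farFrom-split r R T {w} T≤w w≤R = begin
  concatMap (column r (R ∷ T)) (downFrom (length R ⊔ width T))
    ≡⟨ cong (concatMap (column r (R ∷ T)) ∘ downFrom) (m≥n⇒m⊔n≡m (≤-trans T≤w w≤R)) ⟩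
  concatMap (column r (R ∷ T)) (downFrom (length R))
    ≡⟨ cong (concatMap (column r (R ∷ T))) (downFrom-split w≤R) ⟩
  concatMap (column r (R ∷ T)) (columnsFrom w (length R) ++ downFrom w)
    ≡⟨ concatMap-++ (column r (R ∷ T)) (columnsFrom w (length R)) (downFrom w) ⟩
  concatMap (column r (R ∷ T)) (columnsFrom w (length R)) ++ concatMap (column r (R ∷ T)) (downFrom w)
    ≡⟨ cong (_++ concatMap (column r (R ∷ T)) (downFrom w))
            (concatMap-congᴬ (applyDownFrom⁺₂ {P = λ c → column r (R ∷ T) c ≡ cell r R c}
                                               (_+ w) (length R ∸ w) (λ j → only-R (m≤n+m w j)))) ⟩
  cellsFrom r R w ++ concatMap (column r (R ∷ T)) (downFrom w) ∎
  where
  open ≡-Reasoning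
  only-R : ∀ {c} → w ≤ c → column r (R ∷ T) c ≡ cell r R c
  only-R {c} w≤c = trans (cong (cell r R c ++_) (column-beyond (suc r) T (≤-trans T≤w w≤c))) (++-identityʳ (cell r R c))

concatMap-nilᴬ : ∀ {A B : Set} {f : A → List B} {xs} → All (λ x → f x ≡ []) xs → concatMap f xs ≡ []
concatMap-nilᴬ []       = refl
concatMap-nilᴬ (e ∷ es) = cong₂ _++_ e (concatMap-nilᴬ es)

length-concatMap-≤ : ∀ {A B : Set} {f : A → List B} → (∀ x → length (f x) ≤ 1) → ∀ xs →
  length (concatMap f xs) ≤ length xs
length-concatMap-≤ f≤1 []       = z≤n
length-concatMap-≤ {f = f} f≤1 (x ∷ xs) =
  subst (_≤ suc (length xs)) (sym (length-++ (f x))) (+-mono-≤ (f≤1 x) (length-concatMap-≤ f≤1 xs))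

length-cell : ∀ r R c → length (cell r R c) ≤ 1
length-cell r R c with entryAt R c
... | just _  = ≤-refl
... | nothing = z≤n

length-rowReading : ∀ r R → length (rowReading r R) ≤ length R
length-rowReading r R =
  subst (length (rowReading r R) ≤_) (length-downFrom (length R)) (length-concatMap-≤ (length-cell r R) (downFrom (length R)))

-- Cancelling brackets

Br : Set
Br = Bracket × Box

opens closes : List Box → List Br
opens  = map (opn ,_)
closes = map (cls ,_)

-- Cancellation from right to left: `push` puts a bracket in front of an already reduced word.
push : Br → List Br → List Br
push (opn , _) ((cls , _) ∷ ys) = ys
push x ys = x ∷ ys

reduce : List Br → List Br
reduce = foldr push []

reduce-cancelOnce : ∀ s → reduce (cancelOnce s) ≡ reduce s
reduce-cancelOnce []                              = refl
reduce-cancelOnce ((opn , a) ∷ [])                = refl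
reduce-cancelOnce ((opn , a) ∷ (opn , b) ∷ s)     = cong (push (opn , a)) (reduce-cancelOnce ((opn , b) ∷ s))
reduce-cancelOnce ((opn , a) ∷ (cls , b) ∷ s)     = refl
reduce-cancelOnce ((cls , a) ∷ s)                 = cong (push (cls , a)) (reduce-cancelOnce s)

cancelOnce-fixed⇒reduce : ∀ s → cancelOnce s ≡ s → reduce s ≡ s
cancelOnce-fixed⇒reduce []                          _ = refl
cancelOnce-fixed⇒reduce ((opn , a) ∷ [])            _ = refl
cancelOnce-fixed⇒reduce ((opn , a) ∷ (opn , b) ∷ s) e
  rewrite cancelOnce-fixed⇒reduce ((opn , b) ∷ s) (∷-injectiveʳ e) = refl
cancelOnce-fixed⇒reduce ((opn , a) ∷ (cls , b) ∷ s) e = ⊥-elim (m≢1+n+m (length s) (cong length e))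
cancelOnce-fixed⇒reduce ((cls , a) ∷ s)             e
  rewrite cancelOnce-fixed⇒reduce s (∷-injectiveʳ e) = refl

cancelOnce-fixed⊎shrinks : ∀ s → cancelOnce s ≡ s ⊎ 2 + length (cancelOnce s) ≡ length s
cancelOnce-fixed⊎shrinks []                          = inj₁ refl
cancelOnce-fixed⊎shrinks ((opn , a) ∷ [])            = inj₁ refl
cancelOnce-fixed⊎shrinks ((opn , a) ∷ (opn , b) ∷ s) with cancelOnce-fixed⊎shrinks ((opn , b) ∷ s)
... | inj₁ e = inj₁ (cong ((opn , a) ∷_) e)
... | inj₂ e = inj₂ (cong suc e)
cancelOnce-fixed⊎shrinks ((opn , a) ∷ (cls , b) ∷ s) = inj₂ refl
cancelOnce-fixed⊎shrinks ((cls , a) ∷ s) with cancelOnce-fixed⊎shrinks s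
... | inj₁ e = inj₁ (cong ((cls , a) ∷_) e)
... | inj₂ e = inj₂ (cong suc e)

iterate-fixed : ∀ {A : Set} {f : A → A} {x} k → f x ≡ x → iterate k f x ≡ x
iterate-fixed zero    _   = refl
iterate-fixed (suc k) fx≡x rewrite fx≡x = iterate-fixed k fx≡x

iterate-cancelOnce : ∀ k s → length s ≤ k → iterate k cancelOnce s ≡ reduce s
iterate-cancelOnce zero    []      _ = refl
iterate-cancelOnce (suc k) s s≤1+k with cancelOnce-fixed⊎shrinks s
... | inj₁ e rewrite e = trans (iterate-fixed k e) (sym (cancelOnce-fixed⇒reduce s e))
... | inj₂ e = trans (iterate-cancelOnce k (cancelOnce s) shorter) (reduce-cancelOnce s)
  where
  shorter : length (cancelOnce s) ≤ k
  shorter = ≤-pred (≤-trans (n≤1+n _) (subst (_≤ suc k) (sym e) s≤1+k))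

reduced≡reduce : ∀ s → reduced s ≡ reduce s
reduced≡reduce s = iterate-cancelOnce (length s) s ≤-refl

push-open-opens : ∀ b O → push (opn , b) (opens O) ≡ opens (b ∷ O)
push-open-opens b []      = refl
push-open-opens b (_ ∷ _) = refl

push-++-opens : ∀ x zs O → push x (zs ++ opens O) ≡ push x zs ++ opens O
push-++-opens (cls , _) zs               O       = refl
push-++-opens (opn , _) []               []      = refl
push-++-opens (opn , _) []               (_ ∷ _) = refl
push-++-opens (opn , _) ((opn , _) ∷ zs) O       = refl
push-++-opens (opn , _) ((cls , _) ∷ zs) O       = refl

foldr-push-++-opens : ∀ xs ys O → foldr push (ys ++ opens O) xs ≡ foldr push ys xs ++ opens O
foldr-push-++-opens []       ys O = refl
foldr-push-++-opens (x ∷ xs) ys O rewrite foldr-push-++-opens xs ys O = push-++-opens x (foldr push ys xs) O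

reduce-++-opens : ∀ xs {ys O} → reduce ys ≡ opens O → reduce (xs ++ ys) ≡ reduce xs ++ opens O
reduce-++-opens xs {ys} {O} ys-reduces =
  trans (foldr-++ push [] xs ys) (trans (cong (λ z → foldr push z xs) ys-reduces) (foldr-push-++-opens xs [] O))

reduce-normalForm : ∀ W → ∃[ C ] ∃[ O ] reduce W ≡ closes C ++ opens O × length C ≤ length W
reduce-normalForm [] = [] , [] , refl , z≤n
reduce-normalForm ((cls , b) ∷ W) with reduce-normalForm W
... | C , O , e , C≤W rewrite e = b ∷ C , O , refl , s≤s C≤W
reduce-normalForm ((opn , b) ∷ W) with reduce-normalForm W
... | []    , O , e , _   rewrite e = [] , b ∷ O , push-open-opens b O , z≤n
... | _ ∷ C , O , e , C≤W rewrite e = C , O , refl , m≤n⇒m≤1+n (≤-trans (n≤1+n _) C≤W)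

drop-uncons : ∀ {A : Set} k (xs : List A) → k < length xs → ∃[ x ] drop k xs ≡ x ∷ drop (suc k) xs
drop-uncons zero    (x ∷ xs) _   = x , refl
drop-uncons (suc k) (_ ∷ xs) k<n = drop-uncons k xs (≤-pred k<n)

foldr-push-cancel : ∀ ps C Y → length ps ≤ length C →
  foldr push (closes C ++ Y) (opens ps) ≡ closes (drop (length ps) C) ++ Y
foldr-push-cancel []       C Y _    = refl
foldr-push-cancel (p ∷ ps) C Y ps<C with drop-uncons (length ps) C ps<C
... | c , e rewrite foldr-push-cancel ps C Y (≤-trans (n≤1+n _) ps<C) | e = refl

foldr-push-absorbs : ∀ ps C O → length C ≤ length ps → ∃[ O′ ] foldr push (closes C ++ opens O) (opens ps) ≡ opens O′
foldr-push-absorbs [] [] O _ = O , refl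
foldr-push-absorbs (p ∷ ps) C O C≤ps with length C ≤? length ps
... | yes C≤ps′ with foldr-push-absorbs ps C O C≤ps′
...   | O′ , e rewrite e = p ∷ O′ , push-open-opens p O′
foldr-push-absorbs (p ∷ ps) C O C≤ps | no C≰ps′ with drop-uncons (length ps) C (≰⇒> C≰ps′)
... | c , e rewrite foldr-push-cancel ps C (opens O) (<⇒≤ (≰⇒> C≰ps′)) | e
                  | drop-all (suc (length ps)) C C≤ps = O , refl

reduce-opens-++ : ∀ b ps W → length W ≤ length ps → ∃[ O ] reduce (opens (b ∷ ps) ++ W) ≡ opens (b ∷ O)
reduce-opens-++ b ps W W≤ps with reduce-normalForm W
... | C , O , W-reduces , C≤W with foldr-push-absorbs ps C O (≤-trans C≤W W≤ps)
... | O′ , absorbed = O′ , (begin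
  reduce (opens (b ∷ ps) ++ W)                          ≡⟨ foldr-++ push [] (opens (b ∷ ps)) W ⟩
  push (opn , b) (foldr push (reduce W) (opens ps))       ≡⟨ cong (λ z → push (opn , b) (foldr push z (opens ps))) W-reduces ⟩
  push (opn , b) (foldr push (closes C ++ opens O) (opens ps)) ≡⟨ cong (push (opn , b)) absorbed ⟩
  push (opn , b) (opens O′)                           ≡⟨ push-open-opens b O′ ⟩
  opens (b ∷ O′)                                     ∎)
  where open ≡-Reasoning

reduce-openBlocks : ∀ (box : ℕ → Box) (g : ℕ → List Br) cs → (∀ c → length (g c) ≤ 1) →
  ∃[ O ] reduce (concatMap (λ c → (opn , box c) ∷ g c) cs) ≡ opens O
reduce-openBlocks box g []       _ = [] , refl
reduce-openBlocks box g (c ∷ cs) g≤1 with reduce-openBlocks box g cs g≤1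
... | O , e = block (g c) (g≤1 c) O e
  where
  block : ∀ ys → length ys ≤ 1 → ∀ O → reduce (concatMap (λ c → (opn , box c) ∷ g c) cs) ≡ opens O →
    ∃[ O′ ] reduce (((opn , box c) ∷ ys) ++ concatMap (λ c → (opn , box c) ∷ g c) cs) ≡ opens O′
  block []                 _ O e = box c ∷ O , trans (cong (push (opn , box c)) e) (push-open-opens (box c) O)
  block ((opn , y) ∷ [])   _ O e =
    box c ∷ y ∷ O , trans (cong (λ z → push (opn , box c) (push (opn , y) z)) e)
                          (cong (push (opn , box c)) (push-open-opens y O))
  block ((cls , y) ∷ [])   _ O e = O , e
  block (_ ∷ _ ∷ _) (s≤s ())

concatMap-opens : ∀ (box : ℕ → Box) cs → concatMap (λ c → [ (opn , box c) ]) cs ≡ opens (map box cs)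
concatMap-opens box []       = refl
concatMap-opens box (c ∷ cs) = cong ((opn , box c) ∷_) (concatMap-opens box cs)

leftmostOpen-++ : ∀ xs ys → leftmostOpen (xs ++ ys) ≡ (leftmostOpen xs <∣> leftmostOpen ys)
leftmostOpen-++ []              ys = refl
leftmostOpen-++ ((opn , _) ∷ _) ys = refl
leftmostOpen-++ ((cls , _) ∷ xs) ys = leftmostOpen-++ xs ys

rightmostClose-∷ʳ-open : ∀ xs b → rightmostClose (xs ++ [ (opn , b) ]) ≡ rightmostClose xs
rightmostClose-∷ʳ-open xs b rewrite reverse-++ xs [ (opn , b) ] = refl

rightmostClose-++-opens : ∀ xs O → rightmostClose (xs ++ opens O) ≡ rightmostClose xs
rightmostClose-++-opens xs []      = cong rightmostClose (++-identityʳ xs)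
rightmostClose-++-opens xs (b ∷ O) = begin
  rightmostClose (xs ++ (opn , b) ∷ opens O)       ≡⟨ cong rightmostClose (sym (++-assoc xs [ (opn , b) ] (opens O))) ⟩
  rightmostClose ((xs ++ [ (opn , b) ]) ++ opens O) ≡⟨ rightmostClose-++-opens (xs ++ [ (opn , b) ]) O ⟩
  rightmostClose (xs ++ [ (opn , b) ])              ≡⟨ rightmostClose-∷ʳ-open xs b ⟩
  rightmostClose xs                                 ∎
  where open ≡-Reasoning

Interchangeable : List Br → List Br → Set
Interchangeable F M = ∀ P →
  leftmostOpen (reduce (P ++ F)) ≡ leftmostOpen (reduce (P ++ M)) ×
  rightmostClose (reduce (P ++ F)) ≡ rightmostClose (reduce (P ++ M))

interchangeable-++ : ∀ X {F M} → Interchangeable F M → Interchangeable (X ++ F) (X ++ M)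
interchangeable-++ X {F} {M} F~M P rewrite sym (++-assoc P X F) | sym (++-assoc P X M) = F~M (P ++ X)

interchangeable-opening : ∀ {F M b O₁ O₂} → reduce F ≡ opens (b ∷ O₁) → reduce M ≡ opens (b ∷ O₂) →
  Interchangeable F M
interchangeable-opening {b = b} F-reduces M-reduces P =
  trans (leftmost F-reduces) (sym (leftmost M-reduces)) , trans (rightmost F-reduces) (sym (rightmost M-reduces))
  where
  leftmost : ∀ {G O} → reduce G ≡ opens (b ∷ O) → leftmostOpen (reduce (P ++ G)) ≡ (leftmostOpen (reduce P) <∣> just b)
  leftmost e = trans (cong leftmostOpen (reduce-++-opens P e)) (leftmostOpen-++ (reduce P) _)
  rightmost : ∀ {G O} → reduce G ≡ opens O → rightmostClose (reduce (P ++ G)) ≡ rightmostClose (reduce P)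
  rightmost {O = O} e = trans (cong rightmostClose (reduce-++-opens P e)) (rightmostClose-++-opens (reduce P) O)

-- Brackets of the two readings

-- The i-arrow letters other than k itself lie after k and cannot occur in rows k+2, k+3, …
Clear : ℕ → ℕ → Letter → Set
Clear n k y = k < rank n y × (rank n y ≤ suc k ⊎ rank n (neg (suc (suc k))) < rank n y)

module Brackets (n i : ℕ) where

  brackets : List Box → List Br
  brackets = bracketSeq n i

  brackets-++ : ∀ xs ys → brackets (xs ++ ys) ≡ brackets xs ++ brackets ys
  brackets-++ = concatMap-++ (bracketOf n i)

  brackets-concatMap : ∀ {A : Set} (g : A → List Box) xs → brackets (concatMap g xs) ≡ concatMap (brackets ∘ g) xs
  brackets-concatMap g []       = refl
  brackets-concatMap g (x ∷ xs) =
    trans (brackets-++ (g x) (concatMap g xs)) (cong (brackets (g x) ++_) (brackets-concatMap g xs))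

  length-bracketOf : ∀ b → length (bracketOf n i b) ≤ 1
  length-bracketOf (r , c , a) with arrowIn n i a | arrowOut n i a
  ... | just _  | _       = ≤-refl
  ... | nothing | just _  = ≤-refl
  ... | nothing | nothing = z≤n

  length-brackets : ∀ xs → length (brackets xs) ≤ length xs
  length-brackets = length-concatMap-≤ length-bracketOf

  Inert : Letter → Set
  Inert a = ∀ r c → bracketOf n i (r , c , a) ≡ []

  Opener : Letter → Set
  Opener a = ∀ r c → bracketOf n i (r , c , a) ≡ (opn , (r , c , a)) ∷ []

  brackets-cell-inert : ∀ r R c → All Inert R → brackets (cell r R c) ≡ []
  brackets-cell-inert r R c inert with entryAt R c in eq
  ... | just a  = cong (_++ []) (All-entryAt inert eq r c)
  ... | nothing = refl

  brackets-column-inert : ∀ r rows c → All (All Inert) rows → brackets (column r rows c) ≡ []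
  brackets-column-inert r []         c []               = refl
  brackets-column-inert r (R ∷ rows) c (inertR ∷ inert) =
    trans (brackets-++ (cell r R c) (column (suc r) rows c))
          (cong₂ _++_ (brackets-cell-inert r R c inertR) (brackets-column-inert (suc r) rows c inert))

  brackets-middle-inert : ∀ r rows → All (All Inert) rows → brackets (middleFrom r rows) ≡ []
  brackets-middle-inert r []         []               = refl
  brackets-middle-inert r (R ∷ rows) (inertR ∷ inert) =
    trans (brackets-++ (rowReading r R) (middleFrom (suc r) rows))
          (cong₂ _++_ (trans (brackets-concatMap (cell r R) (downFrom (length R)))
                             (concatMap-nilᴬ (All.universal (λ c → brackets-cell-inert r R c inertR) (downFrom (length R)))))
                      (brackets-middle-inert (suc r) rows inert))

  brackets-cell-replicate : ∀ r a N {d c} → c < d → brackets (cell r (replicate d a ++ N) c) ≡ bracketOf n i (r , c , a)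
  brackets-cell-replicate r a N c<d rewrite entryAt-replicate a N c<d = ++-identityʳ _

  length-brackets-column : ∀ r T c → All (All Inert) (drop 1 T) → length (brackets (column r T c)) ≤ 1
  length-brackets-column r []         c _     = z≤n
  length-brackets-column r (R ∷ rows) c inert
    rewrite brackets-++ (cell r R c) (column (suc r) rows c) | brackets-column-inert (suc r) rows c inert
          | ++-identityʳ (brackets (cell r R c)) =
    ≤-trans (length-brackets (cell r R c)) (length-cell r R c)

  length-brackets-middle : ∀ r T → All (All Inert) (drop 1 T) → length (brackets (middleFrom r T)) ≤ headLen T
  length-brackets-middle r []         _     = z≤n
  length-brackets-middle r (R ∷ rows) inert
    rewrite brackets-++ (rowReading r R) (middleFrom (suc r) rows) | brackets-middle-inert (suc r) rows inert
          | ++-identityʳ (brackets (rowReading r R)) =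
    ≤-trans (length-brackets (rowReading r R)) (length-rowReading r R)

  brackets-far-split : ∀ s R T {w} → width T ≤ w → w ≤ length R →
    brackets (farFrom s (R ∷ T)) ≡
    brackets (cellsFrom s R w) ++ concatMap (λ c → brackets (cell s R c) ++ brackets (column (suc s) T c)) (downFrom w)
  brackets-far-split s R T {w} T≤w w≤R = begin
    brackets (farFrom s (R ∷ T))
      ≡⟨ cong brackets (farFrom-split s R T T≤w w≤R) ⟩
    brackets (cellsFrom s R w ++ concatMap (column s (R ∷ T)) (downFrom w))
      ≡⟨ brackets-++ (cellsFrom s R w) _ ⟩
    brackets (cellsFrom s R w) ++ brackets (concatMap (column s (R ∷ T)) (downFrom w))
      ≡⟨ cong (brackets (cellsFrom s R w) ++_)
              (trans (brackets-concatMap (column s (R ∷ T)) (downFrom w))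
                     (concatMap-cong (λ c → brackets-++ (cell s R c) (column (suc s) T c)) (downFrom w))) ⟩
    brackets (cellsFrom s R w) ++ concatMap (λ c → brackets (cell s R c) ++ brackets (column (suc s) T c)) (downFrom w) ∎
    where open ≡-Reasoning

  brackets-middle-split : ∀ s R T {w} → w ≤ length R →
    brackets (middleFrom s (R ∷ T)) ≡
    brackets (cellsFrom s R w) ++ (concatMap (brackets ∘ cell s R) (downFrom w) ++ brackets (middleFrom (suc s) T))
  brackets-middle-split s R T {w} w≤R = begin
    brackets (rowReading s R ++ middleFrom (suc s) T)
      ≡⟨ brackets-++ (rowReading s R) (middleFrom (suc s) T) ⟩
    brackets (rowReading s R) ++ brackets (middleFrom (suc s) T)
      ≡⟨ cong (λ z → brackets z ++ brackets (middleFrom (suc s) T)) (rowReading-split s R w≤R) ⟩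
    brackets (cellsFrom s R w ++ concatMap (cell s R) (downFrom w)) ++ brackets (middleFrom (suc s) T)
      ≡⟨ cong (_++ brackets (middleFrom (suc s) T))
              (trans (brackets-++ (cellsFrom s R w) _)
                     (cong (brackets (cellsFrom s R w) ++_) (brackets-concatMap (cell s R) (downFrom w)))) ⟩
    (brackets (cellsFrom s R w) ++ concatMap (brackets ∘ cell s R) (downFrom w)) ++ brackets (middleFrom (suc s) T)
      ≡⟨ ++-assoc (brackets (cellsFrom s R w)) _ _ ⟩
    brackets (cellsFrom s R w) ++ (concatMap (brackets ∘ cell s R) (downFrom w) ++ brackets (middleFrom (suc s) T)) ∎
    where open ≡-Reasoning

  record OpenerRow : Set where
    field
      k           : ℕ
      1≤k         : 1 ≤ k
      k≤n∸1       : k ≤ n ∸ 1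
      opener      : Opener (pos k)
      inert-above : ∀ {l} → l < k → Inert (pos l)
      inert-below : ∀ {l x} → suc k < l → InBand n l x → Inert x

  openerRow : ∀ {k b₁ a₂ b₂} → arrows n i ≡ (pos k , b₁) ∷ (a₂ , b₂) ∷ [] → 1 ≤ k → k ≤ n ∸ 1 →
    Clear n k b₁ → Clear n k a₂ → Clear n k b₂ → OpenerRow
  openerRow {k} {b₁} {a₂} {b₂} arrows≡ 1≤k k≤n∸1 clear₁ clear₂ clear₃ = record
    { k           = k
    ; 1≤k         = 1≤k
    ; k≤n∸1       = k≤n∸1
    ; opener      = opener
    ; inert-above = λ {l} l<k → inert {pos l} (inj₂ l<k ∷ All.map (λ clear → inj₂ (<-trans l<k (proj₁ clear))) clears)
    ; inert-below = λ {l} {x} k<l band →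
        inert {x} (inj₁ (<-≤-trans (<-trans (n<1+n k) k<l) (proj₁ band)) ∷ All.map (λ {y} → clear-apart {l} {x} k<l band {y}) clears)
    }
    where
    Apart : Letter → Letter → Set
    Apart x y = rank n y < rank n x ⊎ rank n x < rank n y

    clears : All (Clear n k) (b₁ ∷ a₂ ∷ b₂ ∷ [])
    clears = clear₁ ∷ clear₂ ∷ clear₃ ∷ []

    apart⇒==L-false : ∀ x y → Apart x y → y ==L x ≡ false
    apart⇒==L-false x y (inj₁ y<x) = rank≢⇒==L-false y x (<⇒≢ y<x)
    apart⇒==L-false x y (inj₂ x<y) = rank≢⇒==L-false y x (>⇒≢ x<y)

    inert : ∀ {x} → All (Apart x) (pos k ∷ b₁ ∷ a₂ ∷ b₂ ∷ []) → Inert x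
    inert {x} (apart₀ ∷ apart₁ ∷ apart₂ ∷ apart₃ ∷ []) r c
      rewrite arrows≡ | apart⇒==L-false x b₁ apart₁ | apart⇒==L-false x b₂ apart₃
            | apart⇒==L-false x (pos k) apart₀ | apart⇒==L-false x a₂ apart₂ = refl

    opener : Opener (pos k)
    opener r c rewrite arrows≡ | apart⇒==L-false (pos k) b₁ (inj₂ (proj₁ clear₁))
                     | apart⇒==L-false (pos k) b₂ (inj₂ (proj₁ clear₃)) | ==L-refl (pos k) = refl

    clear-apart : ∀ {l x} → suc k < l → InBand n l x → ∀ {y} → Clear n k y → Apart x y
    clear-apart k<l (l≤x , _) (_ , inj₁ y≤1+k) = inj₁ (<-≤-trans (≤-<-trans y≤1+k k<l) l≤x)
    clear-apart k<l (_ , x≤l̄) (_ , inj₂ k̄<y) = inj₂ (≤-<-trans (≤-trans x≤l̄ (∸-monoʳ-≤ (2 + n + n) k<l)) k̄<y)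

  module _ (row : OpenerRow) where
    open OpenerRow row

    rows-inert : ∀ l rows → rowsOK n l rows ≡ true → suc k < l → All (All Inert) rows
    rows-inert l []         _  _   = []
    rows-inert l (R ∷ rows) ok k<l with ∧-true {rowOK n l R (headLen rows)} ok
    ... | okR , okRows =
      All.map (inert-below k<l) (row-inBand n l R (headLen rows) okR) ∷ rows-inert (suc l) rows okRows (m<n⇒m<1+n k<l)

    rows-inert-belowHead : ∀ T → rowsOK n (suc k) T ≡ true → All (All Inert) (drop 1 T)
    rows-inert-belowHead []         _  = []
    rows-inert-belowHead (R ∷ rows) ok = rows-inert (suc (suc k)) rows (proj₂ (∧-true {rowOK n (suc k) R (headLen rows)} ok)) ≤-refl

    prefix-step : ∀ s l R T → rowsOK n l (R ∷ T) ≡ true → l < k →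
      ∃[ X ] brackets (farFrom s (R ∷ T)) ≡ X ++ brackets (farFrom (suc s) T) ×
             brackets (middleFrom s (R ∷ T)) ≡ X ++ brackets (middleFrom (suc s) T)
    prefix-step s l R T ok l<k with ∧-true {rowOK n l R (headLen T)} ok
    ... | okR , okT with row-shape n l R (headLen T) okR
    ... | N , refl = X , far , middle
      where
      open ≡-Reasoning
      w = headLen T
      X = brackets (cellsFrom s R w)
      width≡w : width T ≡ w
      width≡w = width-rowsOK n (suc l) T okT
      w≤R : w ≤ length R
      w≤R = <⇒≤ (row-longer n l R w okR)
      inert-cell : ∀ {c} → c < w → brackets (cell s R c) ≡ []
      inert-cell c<w = trans (brackets-cell-replicate s (pos l) N (m<n⇒m<1+n c<w)) (inert-above l<k s _)

      far : brackets (farFrom s (R ∷ T)) ≡ X ++ brackets (farFrom (suc s) T)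
      far = begin
        brackets (farFrom s (R ∷ T))
          ≡⟨ brackets-far-split s R T (≤-reflexive width≡w) w≤R ⟩
        X ++ concatMap (λ c → brackets (cell s R c) ++ brackets (column (suc s) T c)) (downFrom w)
          ≡⟨ cong (X ++_) (concatMap-congᴬ (applyDownFrom⁺₁ {P = λ c → brackets (cell s R c) ++ brackets (column (suc s) T c)
                                                                         ≡ brackets (column (suc s) T c)}
                                                             id w (λ c<w → cong (_++ _) (inert-cell c<w)))) ⟩
        X ++ concatMap (brackets ∘ column (suc s) T) (downFrom w)
          ≡⟨ cong (X ++_) (sym (brackets-concatMap (column (suc s) T) (downFrom w))) ⟩
        X ++ brackets (concatMap (column (suc s) T) (downFrom w))
          ≡⟨ cong (λ v → X ++ brackets (concatMap (column (suc s) T) (downFrom v))) (sym width≡w) ⟩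
        X ++ brackets (farFrom (suc s) T) ∎

      middle : brackets (middleFrom s (R ∷ T)) ≡ X ++ brackets (middleFrom (suc s) T)
      middle = begin
        brackets (middleFrom s (R ∷ T))
          ≡⟨ brackets-middle-split s R T w≤R ⟩
        X ++ (concatMap (brackets ∘ cell s R) (downFrom w) ++ brackets (middleFrom (suc s) T))
          ≡⟨ cong (λ z → X ++ (z ++ brackets (middleFrom (suc s) T)))
                  (concatMap-nilᴬ (applyDownFrom⁺₁ {P = λ c → brackets (cell s R c) ≡ []} id w inert-cell)) ⟩
        X ++ brackets (middleFrom (suc s) T) ∎

    opener-step : ∀ s R T → rowsOK n k (R ∷ T) ≡ true →
      Interchangeable (brackets (farFrom s (R ∷ T))) (brackets (middleFrom s (R ∷ T)))
    opener-step s R T ok with ∧-true {rowOK n k R (headLen T)} ok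
    ... | okR , okT with row-shape n k R (headLen T) okR
    ... | N , refl =
      subst₂ Interchangeable (sym far) (sym middle)
             (interchangeable-++ X (interchangeable-opening (proj₂ far-opening) (proj₂ middle-opening)))
      where
      open ≡-Reasoning
      m = headLen T
      X = brackets (cellsFrom s R (suc m))
      box : ℕ → Box
      box c = s , c , pos k
      below : ℕ → List Br
      below c = brackets (column (suc s) T c)
      width≤m : width T ≤ m
      width≤m = ≤-reflexive (width-rowsOK n (suc k) T okT)
      inert-belowHead = rows-inert-belowHead T okT
      opening-cell : ∀ {c} → c < suc m → brackets (cell s R c) ≡ (opn , box c) ∷ []
      opening-cell c<1+m = trans (brackets-cell-replicate s (pos k) N c<1+m) (opener s _)

      far : brackets (farFrom s (R ∷ T)) ≡ X ++ ((opn , box m) ∷ concatMap (λ c → (opn , box c) ∷ below c) (downFrom m))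
      far = begin
        brackets (farFrom s (R ∷ T))
          ≡⟨ brackets-far-split s R T (m≤n⇒m≤1+n width≤m) (row-longer n k R m okR) ⟩
        X ++ concatMap (λ c → brackets (cell s R c) ++ below c) (downFrom (suc m))
          ≡⟨ cong (X ++_) (concatMap-congᴬ (applyDownFrom⁺₁ {P = λ c → brackets (cell s R c) ++ below c ≡ (opn , box c) ∷ below c}
                                                             id (suc m) (λ c<1+m → cong (_++ _) (opening-cell c<1+m)))) ⟩
        X ++ ((opn , box m) ∷ below m ++ concatMap (λ c → (opn , box c) ∷ below c) (downFrom m))
          ≡⟨ cong (λ z → X ++ ((opn , box m) ∷ z ++ concatMap (λ c → (opn , box c) ∷ below c) (downFrom m)))
                  (cong brackets (column-beyond (suc s) T width≤m)) ⟩
        X ++ ((opn , box m) ∷ concatMap (λ c → (opn , box c) ∷ below c) (downFrom m)) ∎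

      middle : brackets (middleFrom s (R ∷ T)) ≡ X ++ (opens (box m ∷ map box (downFrom m)) ++ brackets (middleFrom (suc s) T))
      middle = begin
        brackets (middleFrom s (R ∷ T))
          ≡⟨ brackets-middle-split s R T (row-longer n k R m okR) ⟩
        X ++ (concatMap (brackets ∘ cell s R) (downFrom (suc m)) ++ brackets (middleFrom (suc s) T))
          ≡⟨ cong (λ z → X ++ (z ++ brackets (middleFrom (suc s) T)))
                  (trans (concatMap-congᴬ (applyDownFrom⁺₁ {P = λ c → brackets (cell s R c) ≡ (opn , box c) ∷ []}
                                                           id (suc m) opening-cell))
                         (concatMap-opens box (downFrom (suc m)))) ⟩
        X ++ (opens (box m ∷ map box (downFrom m)) ++ brackets (middleFrom (suc s) T)) ∎

      far-opening : ∃[ O ] reduce ((opn , box m) ∷ concatMap (λ c → (opn , box c) ∷ below c) (downFrom m)) ≡ opens (box m ∷ O)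
      far-opening with reduce-openBlocks box below (downFrom m) (λ c → length-brackets-column (suc s) T c inert-belowHead)
      ... | O , blocks-reduce = O , trans (cong (push (opn , box m)) blocks-reduce) (push-open-opens (box m) O)

      middle-opening : ∃[ O ] reduce (opens (box m ∷ map box (downFrom m)) ++ brackets (middleFrom (suc s) T)) ≡ opens (box m ∷ O)
      middle-opening = reduce-opens-++ (box m) (map box (downFrom m)) (brackets (middleFrom (suc s) T))
        (≤-trans (length-brackets-middle (suc s) T inert-belowHead)
                 (≤-reflexive (sym (trans (length-map box (downFrom m)) (length-downFrom m)))))

    interchangeable-from : ∀ s T → rowsOK n (suc s) T ≡ true → suc s ≤ k → k ≤ length T + s →
      Interchangeable (brackets (farFrom s T)) (brackets (middleFrom s T))
    interchangeable-from s []      _  s<k k≤s = ⊥-elim (<⇒≱ s<k k≤s)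
    interchangeable-from s (R ∷ T) ok s<k k≤ with suc s ≟ k
    ... | yes s≡k = opener-step s R T (subst (λ l → rowsOK n l (R ∷ T) ≡ true) s≡k ok)
    ... | no  s≢k with prefix-step s (suc s) R T ok (≤∧≢⇒< s<k s≢k)
    ...   | X , far , middle =
      subst₂ Interchangeable (sym far) (sym middle)
             (interchangeable-++ X (interchangeable-from (suc s) T okT (≤∧≢⇒< s<k s≢k)
                                     (subst (k ≤_) (sym (+-suc (length T) s)) k≤)))
      where
      okT = proj₂ (∧-true {rowOK n (suc s) R (headLen T)} ok)

    readings-interchangeable : ∀ T → isMarginallyLarge n T ≡ true →
      Interchangeable (brackets (farEastern T)) (brackets (middleEastern T))
    readings-interchangeable T ml with ∧-true {length T ≡ᵇ (n ∸ 1)} ml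
    ... | len , ok rewrite farEastern≡farFrom T | middleEastern≡middleFrom T =
      interchangeable-from 0 T ok 1≤k
        (subst (k ≤_) (sym (trans (+-identityʳ (length T)) (≡ᵇ-true⇒≡ len))) k≤n∸1)

-- The i-arrows of type D_n

rank-neg> : ∀ {n j} → j ≤ n → n < rank n (neg j)
rank-neg> {n} {j} j≤n =
  <-≤-trans (m<n⇒m<1+n (n<1+n n)) (≤-trans (≤-reflexive (sym (m+n∸n≡m (2 + n) n))) (∸-monoʳ-≤ (2 + n + n) j≤n))

clear-pos : ∀ n {k} → Clear n k (pos (suc k))
clear-pos n = ≤-refl , inj₁ ≤-refl

clear-neg : ∀ n {k j} → j ≤ suc k → k < n → j ≤ n → Clear n k (neg j)
clear-neg n j≤1+k k<n j≤n =
  <-trans k<n (rank-neg> j≤n) , inj₂ (∸-monoʳ-< (s≤s j≤1+k) (s≤s (s≤s (≤-trans (<⇒≤ k<n) (m≤m+n n n)))))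

m+2≰n : ∀ {m n} → n ≤ suc m → ¬ (m + 2 ≤ n)
m+2≰n {m} n≤1+m m+2≤n = 1+n≰n (≤-trans (≤-trans (≤-reflexive (+-comm 2 m)) m+2≤n) n≤1+m)

arrows-inner : ∀ {n i} → 1 ≤ i → i + 2 ≤ n → arrows n i ≡ (pos i , pos (suc i)) ∷ (neg (suc i) , neg i) ∷ []
arrows-inner 1≤i i+2≤n rewrite ≤⇒≤ᵇ-true 1≤i | ≤⇒≤ᵇ-true i+2≤n = refl

arrows-penultimate : ∀ m → arrows (suc m) m ≡ (pos m , pos (suc m)) ∷ (neg (suc m) , neg m) ∷ []
arrows-penultimate m rewrite ≰⇒≤ᵇ-false (m+2≰n {m} ≤-refl) | ∧-zeroʳ (1 ≤ᵇ m) | ≡ᵇ-refl m = refl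

arrows-last : ∀ m → arrows (suc m) (suc m) ≡ (pos m , neg (suc m)) ∷ (pos (suc m) , neg m) ∷ []
arrows-last m rewrite ≰⇒≤ᵇ-false (m+2≰n {suc m} (n≤1+n (suc m))) | ≢⇒≡ᵇ-false (1+n≢n {m}) | ≡ᵇ-refl m = refl

openerRow-of : ∀ {n i} → 4 ≤ n → 1 ≤ i → i ≤ n → Brackets.OpenerRow n i
openerRow-of {suc m} {i} (s≤s 3≤m) 1≤i i≤1+m with i ≟ suc m | i ≟ m
... | yes refl | _ =
  Brackets.openerRow (suc m) (suc m) (arrows-last m) 1≤m ≤-refl
    (clear-neg (suc m) ≤-refl ≤-refl ≤-refl) (clear-pos (suc m)) (clear-neg (suc m) (n≤1+n m) ≤-refl (n≤1+n m))
  where 1≤m = ≤-trans (s≤s z≤n) 3≤m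
... | no _ | yes refl =
  Brackets.openerRow (suc m) m (arrows-penultimate m) 1≤m ≤-refl
    (clear-pos (suc m)) (clear-neg (suc m) ≤-refl ≤-refl ≤-refl) (clear-neg (suc m) (n≤1+n m) ≤-refl (n≤1+n m))
  where 1≤m = ≤-trans (s≤s z≤n) 3≤m
... | no i≢1+m | no i≢m =
  Brackets.openerRow (suc m) i (arrows-inner 1≤i (subst (_≤ suc m) (+-comm 2 i) 2+i≤1+m)) 1≤i (<⇒≤ i<m)
    (clear-pos (suc m)) (clear-neg (suc m) ≤-refl i<1+m i<1+m) (clear-neg (suc m) (n≤1+n i) i<1+m (<⇒≤ i<1+m))
  where
  i<m = ≤∧≢⇒< (≤-pred (≤∧≢⇒< i≤1+m i≢1+m)) i≢m
  i<1+m = m<n⇒m<1+n i<m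
  2+i≤1+m = s≤s i<m

fOp-cong : ∀ {n i} rd₁ rd₂ T → leftmostOpen (reduce (bracketSeq n i (rd₁ T))) ≡ leftmostOpen (reduce (bracketSeq n i (rd₂ T))) →
  fOp n i rd₁ T ≡ fOp n i rd₂ T
fOp-cong {n} {i} rd₁ rd₂ T e
  rewrite reduced≡reduce (bracketSeq n i (rd₁ T)) | reduced≡reduce (bracketSeq n i (rd₂ T)) | e = refl

eOp-cong : ∀ {n i} rd₁ rd₂ T → rightmostClose (reduce (bracketSeq n i (rd₁ T))) ≡ rightmostClose (reduce (bracketSeq n i (rd₂ T))) →
  eOp n i rd₁ T ≡ eOp n i rd₂ T
eOp-cong {n} {i} rd₁ rd₂ T e
  rewrite reduced≡reduce (bracketSeq n i (rd₁ T)) | reduced≡reduce (bracketSeq n i (rd₂ T)) | e = refl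

proposition2p7 : (n : ℕ) → 4 ≤ n → (T : Tableau) → isMarginallyLarge n T ≡ true →
    (i : ℕ) → 1 ≤ i → i ≤ n →
    (fOp n i farEastern T ≡ fOp n i middleEastern T) ×
    (eOp n i farEastern T ≡ eOp n i middleEastern T)
proposition2p7 n 4≤n T ml i 1≤i i≤n =
  fOp-cong farEastern middleEastern T (proj₁ agree) , eOp-cong farEastern middleEastern T (proj₂ agree)
  where
  agree = Brackets.readings-interchangeable n i (openerRow-of 4≤n 1≤i i≤n) T ml []
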